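{- Fix an integer $d\ge 1$ and a periodic set $\mathbf{A}=(A,t_A)$, where $t_A\ge 1$ is an integer and $A=\{a_0,a_1,\dots,a_k\}$ with $0=a_0<a_1<\dots<a_k<t_A$. Then the formal power series $P^r(\mathbf{A},t)$, $r\in A$, satisfy the system of linear equations in $\mathbb{Q}[\![t]\!]$ $$P^r(\mathbf{A},t)-\sum_{q\in A}\,[E(t)]_{t_A,\,Sh(r,q)}\;P^q(\mathbf{A},t)=E^{\infty}(t),\qquad r\in A,$$ and this system (with the $P^r(\mathbf{A},t)$, $r\in A$, as unknowns) has a unique solution in $\mathbb{Q}[\![t]\!]$.
   Context: A directed lattice path (DLP) in $\mathbb{Z}_{\ge 0}\times\mathbb{Z}^d$ (first coordinate = "time", the set $\{(x,0):x\ge0\}$ with $0\in\mathbb{Z}^d$ is the $T$-axis) is a sequence of lattice points in which each step is of the form $(1,s)$ with $s\in\{ -1,1\}^d$; its length is its number of steps. Two DLPs are equal iff they have the same starting point and the same sequence of steps. Only DLPs of even length are considered, and generating functions are ordinary generating functions in which the exponent of $t$ is half the length of the path. For the periodic set $\mathbf{A}=(A,t_A)$, a point $(2m,0)$ of the $T$-axis is called admissible if $m \bmod t_A\in A$. For $r\in A$, $P^r(\mathbf{A},t)=\sum_{n\ge0}p_nt^n$, where $p_n$ is the number of DLPs of length $2n$ starting at $(2r,0)$ all of whose points lying on the $T$-axis are admissible. $E(t)=\sum_{n\ge1}e_nt^n$, where $e_n$ is the number of DLPs of length $2n$ (no restrictions) starting at the origin, ending on the $T$-axis and not touching the $T$-axis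 at any intermediate point (primitive $T$-excursions). $E^{\infty}(t)=\sum_{n\ge0}f_nt^n$, where $f_n$ is the number of DLPs of length $2n$ (no restrictions) starting at the origin that never return to the $T$-axis after time $0$ (escaping paths). For $G(t)=\sum_i g_it^i$ and integers $0\le r<q$, the multisection is $[G(t)]_{q,r}=\sum_{i\ge0}g_{qi+r}t^{qi+r}$. For $j,q\in\{0,\dots,t_A-1\}$, $Sh(j,q)=q-j$ if $j\le q$ and $Sh(j,q)=t_A+q-j$ if $j>q$ (the distance from $(2j,0)$ to the nearest point $(2y,0)$ with $y\ge j$ and $y\equiv q \pmod{t_A}$, measured in half-lengths). -}

module Defs where

open import Data.Bool using (Bool; true; false; _∧_; not; if_then_else_)
open import Data.Nat as ℕ using (ℕ; zero; suc; _≤ᵇ_; _≡ᵇ_; NonZero; ⌊_/2⌋)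
open import Data.Nat.DivMod using (_%_)
open import Data.Integer as ℤ using (ℤ; +_)
open import Data.Rational as ℚ using (ℚ; 0ℚ)
open import Data.List using (List; []; _∷_; map; concatMap; length; filterᵇ; foldr; upTo)
open import Data.Vec using (Vec; []; _∷_; replicate; zipWith)
open import Data.List.Membership.DecPropositional ℕ._≟_ using (_∈?_)
open import Relation.Nullary.Decidable using (isYes)
open import Relation.Binary.PropositionalEquality using (_≡_)

FPS : Set
FPS = ℕ → ℚ

_≈ₚ_ : FPS → FPS → Set
F ≈ₚ G = ∀ n → F n ≡ G n

_+ₚ_ : FPS → FPS → FPS
(F +ₚ G) n = F n ℚ.+ G n

_-ₚ_ : FPS → FPS → FPS
(F -ₚ G) n = F n ℚ.- G n

0ₚ : FPS
0ₚ _ = 0ℚ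

sumℚ : List ℚ → ℚ
sumℚ = foldr ℚ._+_ 0ℚ

_*ₚ_ : FPS → FPS → FPS
(F *ₚ G) n = sumℚ (map (λ i → F i ℚ.* G (n ℕ.∸ i)) (upTo (suc n)))

sumₚ : List ℕ → (ℕ → FPS) → FPS
sumₚ []       f = 0ₚ
sumₚ (q ∷ qs) f = f q +ₚ sumₚ qs f

multisection : (m : ℕ) .{{_ : NonZero m}} → ℕ → FPS → FPS
multisection m s G i = if (i % m) ≡ᵇ s then G i else 0ℚ

Sh : ℕ → ℕ → ℕ → ℕ
Sh tA j q = if j ≤ᵇ q then q ℕ.∸ j else (tA ℕ.+ q) ℕ.∸ j

-- Directed lattice paths in ℤ≥0 × ℤ^d.
-- A step (1,s), s ∈ {-1,1}^d, is encoded by Vec Bool d (true = +1, false = -1).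
-- A DLP is its starting point together with its list of steps.

Step : ℕ → Set
Step d = Vec Bool d

allVecs : {X : Set} (n : ℕ) → List X → List (Vec X n)
allVecs zero    xs = [] ∷ []
allVecs (suc n) xs = concatMap (λ x → map (x ∷_) (allVecs n xs)) xs

allSteps : (d : ℕ) → List (Step d)
allSteps d = allVecs d (true ∷ false ∷ [])

allPaths : (d L : ℕ) → List (List (Step d))
allPaths d zero    = [] ∷ []
allPaths d (suc L) = concatMap (λ s → map (s ∷_) (allPaths d L)) (allSteps d)

count : {X : Set} → (X → Bool) → List X → ℕ
count p xs = length (filterᵇ p xs)

origin : (d : ℕ) → Vec ℤ d
origin d = replicate d (+ 0)

move : {d : ℕ} → Step d → Vec ℤ d → Vec ℤ d
move s x = zipWith (λ b z → if b then z ℤ.+ ℤ.1ℤ else z ℤ.- ℤ.1ℤ) s x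

onAxis : {d : ℕ} → Vec ℤ d → Bool
onAxis []            = true
onAxis (+ zero ∷ xs) = onAxis xs
onAxis (_ ∷ xs)      = false

evenᵇ : ℕ → Bool
evenᵇ zero          = true
evenᵇ (suc zero)    = false
evenᵇ (suc (suc n)) = evenᵇ n

pointOK : (A : List ℕ) (tA : ℕ) .{{_ : NonZero tA}} {d : ℕ} → ℕ → Vec ℤ d → Bool
pointOK A tA x pos =
  if onAxis pos then (evenᵇ x ∧ isYes ((⌊ x /2⌋ % tA) ∈? A)) else true

admissiblePath : (A : List ℕ) (tA : ℕ) .{{_ : NonZero tA}} {d : ℕ} →
                 ℕ → Vec ℤ d → List (Step d) → Bool
admissiblePath A tA x pos []       = pointOK A tA x pos
admissiblePath A tA x pos (s ∷ ss) =
  pointOK A tA x pos ∧ admissiblePath A tA (suc x) (move s pos) ss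

-- primitive T-excursion: ends on the axis, no intermediate point on the axis
-- (the empty path is not counted)
excursion : {d : ℕ} → Vec ℤ d → List (Step d) → Bool
excursion pos []             = false
excursion pos (s ∷ [])       = onAxis (move s pos)
excursion pos (s ∷ s' ∷ ss)  = not (onAxis (move s pos)) ∧ excursion (move s pos) (s' ∷ ss)

escaping : {d : ℕ} → Vec ℤ d → List (Step d) → Bool
escaping pos []       = true
escaping pos (s ∷ ss) = not (onAxis (move s pos)) ∧ escaping (move s pos) ss

ℕtoℚ : ℕ → ℚ
ℕtoℚ n = (+ n) ℚ./ 1

P : (d : ℕ) (A : List ℕ) (tA : ℕ) .{{_ : NonZero tA}} → ℕ → FPS
P d A tA r n = ℕtoℚ (count (admissiblePath A tA (2 ℕ.* r) (origin d)) (allPaths d (2 ℕ.* n)))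

E : (d : ℕ) → FPS
E d n = ℕtoℚ (count (excursion (origin d)) (allPaths d (2 ℕ.* n)))

E∞ : (d : ℕ) → FPS
E∞ d n = ℕtoℚ (count (escaping (origin d)) (allPaths d (2 ℕ.* n)))

lhs : (d : ℕ) (A : List ℕ) (tA : ℕ) .{{_ : NonZero tA}} → (ℕ → FPS) → ℕ → FPS
lhs d A tA X r = X r -ₚ sumₚ A (λ q → multisection tA (Sh tA r q) (E d) *ₚ X q)

Solves : (d : ℕ) (A : List ℕ) (tA : ℕ) .{{_ : NonZero tA}} → (ℕ → FPS) → Set
Solves d A tA X = ∀ r → r Data.List.Membership.Propositional.∈ A → lhs d A tA X r ≈ₚ E∞ d
  where import Data.List.Membership.Propositional

-- A path counted by P^r either never returns to the T-axis, which gives E^∞, or splits at its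
-- first return into a primitive excursion of some length j and an admissible path from
-- (2r + j, 0). Returns at odd times are never admissible, so j = 2i, and the path continues from
-- (2(r + i), 0) exactly as from (2q, 0) when (r + i) mod t_A = q ∈ A, i.e. when
-- i ≡ Sh(r, q) (mod t_A); summing over i gives [E]_{t_A, Sh(r,q)} · P^q. Uniqueness: E has no constant term, so the system determines the
-- coefficients of any solution by induction on the degree.

module Submission where

open import Defs
open import Data.Nat using (ℕ; _≤_; _<_; NonZero)
open import Data.Product using (_×_)
open import Data.List using (List; _∷_)
open import Data.List.Relation.Unary.All using (All)
open import Data.List.Relation.Unary.Linked using (Linked)
open import Data.List.Membership.Propositional using (_∈_)

open import Data.Bool using (Bool; true; false; not; _∧_; if_then_else_; T)
open import Data.Bool.Properties using (T-≡; ⇔→≡; if-cong; if-eta; if-float)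
open import Data.Empty using (⊥-elim)
open import Data.Integer using (ℤ; +0; +[1+_]; -[1+_])
import Data.Integer as ℤ
import Data.Integer.Properties as ℤP
open import Data.List using ([]; map; concatMap; _++_; applyUpTo; length; filterᵇ)
open import Data.List.Properties using (filter-++; length-++)
import Data.List.Relation.Unary.All as All
import Data.List.Relation.Unary.AllPairs as AllPairs
open import Data.List.Relation.Unary.Any using (here; there)
open import Data.List.Relation.Unary.Linked.Properties using (Linked⇒AllPairs)
open import Data.List.Relation.Unary.Unique.Propositional using (Unique; []; _∷_)
open import Data.Nat as ℕ using (zero; suc; _+_; _*_; _∸_; _≡ᵇ_; _≤ᵇ_; ⌊_/2⌋)
import Data.Nat.Properties as ℕP
open import Data.List.Membership.DecPropositional ℕ._≟_ using (_∈?_)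
open import Data.Nat.Coprimality using (1-coprimeTo) renaming (sym to coprime-sym)
open import Data.Nat.DivMod using (_%_; %-distribˡ-+; m%n%n≡m%n; [m+n]%n≡m%n; m<n⇒m%n≡m)
open import Data.Nat.Induction using (<-rec)
open import Data.Product using (_,_)
open import Data.Rational as ℚ using (ℚ; 0ℚ; mkℚ)
import Data.Rational.Properties as ℚP
open import Data.Rational.Unnormalised using (*≡*)
import Data.Rational.Unnormalised.Properties as ℚᵘP
open import Data.Vec using (Vec; []; _∷_)
open import Function.Base using (_∘_)
open import Function.Bundles using (_⇔_; mk⇔; Equivalence)
open import Function.Properties.Equivalence using () renaming (trans to ⇔-trans; sym to ⇔-sym)
open import Relation.Nullary using (¬_; yes; no)
open import Relation.Nullary.Decidable using (T?; isYes; isYes≗does; dec-true; dec-false)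
open import Relation.Binary.PropositionalEquality

open import Algebra.Properties.AbelianGroup ℚP.+-0-abelianGroup using (//-rightDividesˡ; //-rightDividesʳ)
open import Algebra.Properties.CommutativeSemigroup ℕP.+-commutativeSemigroup using (interchange)

ℕtoℚ-normal : ℕ → ℚ
ℕtoℚ-normal n = mkℚ (ℤ.+ n) 0 (coprime-sym (1-coprimeTo n))

ℕtoℚ≡ℕtoℚ-normal : ∀ n → ℕtoℚ n ≡ ℕtoℚ-normal n
ℕtoℚ≡ℕtoℚ-normal n = ℚP.normalize-coprime (coprime-sym (1-coprimeTo n))

ℕtoℚ-+ : ∀ m n → ℕtoℚ (m + n) ≡ ℕtoℚ m ℚ.+ ℕtoℚ n
ℕtoℚ-+ m n rewrite ℕtoℚ≡ℕtoℚ-normal (m + n) | ℕtoℚ≡ℕtoℚ-normal m | ℕtoℚ≡ℕtoℚ-normal n =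
  ℚP.toℚᵘ-injective (ℚᵘP.≃-trans (*≡* numerators)
                                   (ℚᵘP.≃-sym (ℚP.toℚᵘ-homo-+ (ℕtoℚ-normal m) (ℕtoℚ-normal n))))
  where
  numerators : (ℤ.+ (m + n)) ℤ.* ℤ.1ℤ ≡ ((ℤ.+ m) ℤ.* ℤ.1ℤ ℤ.+ (ℤ.+ n) ℤ.* ℤ.1ℤ) ℤ.* ℤ.1ℤ
  numerators rewrite ℤP.*-identityʳ (ℤ.+ m) | ℤP.*-identityʳ (ℤ.+ n)
                   | ℤP.*-identityʳ ((ℤ.+ m) ℤ.+ (ℤ.+ n)) = ℤP.pos-+ m n

ℕtoℚ-* : ∀ m n → ℕtoℚ (m * n) ≡ ℕtoℚ m ℚ.* ℕtoℚ n
ℕtoℚ-* m n rewrite ℕtoℚ≡ℕtoℚ-normal (m * n) | ℕtoℚ≡ℕtoℚ-normal m | ℕtoℚ≡ℕtoℚ-normal n =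
  ℚP.toℚᵘ-injective (ℚᵘP.≃-trans (*≡* numerators)
                                   (ℚᵘP.≃-sym (ℚP.toℚᵘ-homo-* (ℕtoℚ-normal m) (ℕtoℚ-normal n))))
  where
  numerators : (ℤ.+ (m * n)) ℤ.* ℤ.1ℤ ≡ ((ℤ.+ m) ℤ.* (ℤ.+ n)) ℤ.* ℤ.1ℤ
  numerators rewrite ℤP.*-identityʳ ((ℤ.+ m) ℤ.* (ℤ.+ n)) | ℤP.*-identityʳ (ℤ.+ (m * n)) =
    ℤP.pos-* m n

sumMap : {X : Set} → List X → (X → ℕ) → ℕ
sumMap []       f = 0
sumMap (x ∷ xs) f = f x + sumMap xs f

module _ {X : Set} where

  sumMap-cong : (xs : List X) {f g : X → ℕ} → (∀ x → f x ≡ g x) → sumMap xs f ≡ sumMap xs g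
  sumMap-cong []       f≗g = refl
  sumMap-cong (x ∷ xs) f≗g = cong₂ _+_ (f≗g x) (sumMap-cong xs f≗g)

  sumMap-cong-∈ : (xs : List X) {f g : X → ℕ} → (∀ {x} → x ∈ xs → f x ≡ g x) →
                  sumMap xs f ≡ sumMap xs g
  sumMap-cong-∈ []       f≗g = refl
  sumMap-cong-∈ (x ∷ xs) f≗g = cong₂ _+_ (f≗g (here refl)) (sumMap-cong-∈ xs (f≗g ∘ there))

  sumMap-zero : (xs : List X) → sumMap xs (λ _ → 0) ≡ 0
  sumMap-zero []       = refl
  sumMap-zero (x ∷ xs) = sumMap-zero xs

  sumMap-+ : (xs : List X) (f g : X → ℕ) →
             sumMap xs (λ x → f x + g x) ≡ sumMap xs f + sumMap xs g
  sumMap-+ []       f g = refl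
  sumMap-+ (x ∷ xs) f g =
    trans (cong (f x + g x +_) (sumMap-+ xs f g)) (interchange (f x) (g x) _ _)

  sumMap-*ʳ : (xs : List X) (f : X → ℕ) (m : ℕ) → sumMap xs f * m ≡ sumMap xs (λ x → f x * m)
  sumMap-*ʳ []       f m = refl
  sumMap-*ʳ (x ∷ xs) f m =
    trans (ℕP.*-distribʳ-+ m (f x) (sumMap xs f)) (cong (f x * m +_) (sumMap-*ʳ xs f m))

  sumMap-*ˡ : (xs : List X) (f : X → ℕ) (m : ℕ) → m * sumMap xs f ≡ sumMap xs (λ x → m * f x)
  sumMap-*ˡ []       f m = ℕP.*-zeroʳ m
  sumMap-*ˡ (x ∷ xs) f m =
    trans (ℕP.*-distribˡ-+ m (f x) (sumMap xs f)) (cong (m * f x +_) (sumMap-*ˡ xs f m))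

*-if-else-0 : ∀ b m n → m * (if b then n else 0) ≡ (if b then m else 0) * n
*-if-else-0 true  m n = refl
*-if-else-0 false m n = ℕP.*-zeroʳ m

sumBelow : ℕ → (ℕ → ℕ) → ℕ
sumBelow zero    f = 0
sumBelow (suc n) f = f 0 + sumBelow n (f ∘ suc)

sumBelow-cong : ∀ n {f g : ℕ → ℕ} → (∀ i → f i ≡ g i) → sumBelow n f ≡ sumBelow n g
sumBelow-cong zero    f≗g = refl
sumBelow-cong (suc n) f≗g = cong₂ _+_ (f≗g 0) (sumBelow-cong n (f≗g ∘ suc))

sumBelow-zero : ∀ n → sumBelow n (λ _ → 0) ≡ 0
sumBelow-zero zero    = refl
sumBelow-zero (suc n) = sumBelow-zero n

sumBelow-sumMap : {X : Set} (n : ℕ) (xs : List X) (h : ℕ → X → ℕ) →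
                  sumBelow n (λ i → sumMap xs (h i)) ≡ sumMap xs (λ x → sumBelow n (λ i → h i x))
sumBelow-sumMap zero    xs h = sym (sumMap-zero xs)
sumBelow-sumMap (suc n) xs h =
  trans (cong (sumMap xs (h 0) +_) (sumBelow-sumMap n xs (h ∘ suc)))
        (sym (sumMap-+ xs (h 0) (λ x → sumBelow n (λ i → h (suc i) x))))

module _ {X : Set} (p : X → Bool) where

  count-∷ : ∀ x xs → count p (x ∷ xs) ≡ (if p x then 1 else 0) + count p xs
  count-∷ x xs with p x
  ... | true  = refl
  ... | false = refl

  count-++ : ∀ xs ys → count p (xs ++ ys) ≡ count p xs + count p ys
  count-++ xs ys = trans (cong length (filter-++ (T? ∘ p) xs ys)) (length-++ (filterᵇ p xs))

  count-concatMap : {Y : Set} (f : Y → List X) (ys : List Y) →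
                    count p (concatMap f ys) ≡ sumMap ys (λ y → count p (f y))
  count-concatMap f []       = refl
  count-concatMap f (y ∷ ys) =
    trans (count-++ (f y) (concatMap f ys)) (cong (count p (f y) +_) (count-concatMap f ys))

count-map : {X Y : Set} (p : Y → Bool) (f : X → Y) (xs : List X) →
            count p (map f xs) ≡ count (p ∘ f) xs
count-map p f []       = refl
count-map p f (x ∷ xs) =
  trans (count-∷ p (f x) (map f xs)) (trans (cong (_ +_) (count-map p f xs)) (sym (count-∷ (p ∘ f) x xs)))

count-false : {X : Set} (xs : List X) → count (λ _ → false) xs ≡ 0
count-false []       = refl
count-false (x ∷ xs) = count-false xs

≡ᵇ≡true⇔≡ : ∀ {m n} → (m ≡ᵇ n) ≡ true ⇔ m ≡ n
≡ᵇ≡true⇔≡ {m} {n} = ⇔-trans (⇔-sym T-≡) (mk⇔ (ℕP.≡ᵇ⇒≡ m n) (ℕP.≡⇒≡ᵇ m n))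

≡ᵇ-cong : ∀ {a b c e} → (a ≡ b ⇔ c ≡ e) → (a ≡ᵇ b) ≡ (c ≡ᵇ e)
≡ᵇ-cong a≡b⇔c≡e = ⇔→≡ (⇔-trans ≡ᵇ≡true⇔≡ (⇔-trans a≡b⇔c≡e (⇔-sym ≡ᵇ≡true⇔≡)))

module _ (h : ℕ → ℕ) where

  sumMap-select-∉ : ∀ {v} xs → ¬ v ∈ xs → sumMap xs (λ q → if v ≡ᵇ q then h q else 0) ≡ 0
  sumMap-select-∉         []       v∉xs = refl
  sumMap-select-∉ {v} (x ∷ xs) v∉xs with v ≡ᵇ x in v≡ᵇx
  ... | true  = ⊥-elim (v∉xs (here (Equivalence.to ≡ᵇ≡true⇔≡ v≡ᵇx)))
  ... | false = sumMap-select-∉ xs (v∉xs ∘ there)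

  sumMap-select-∈ : ∀ {v xs} → Unique xs → v ∈ xs →
                    sumMap xs (λ q → if v ≡ᵇ q then h q else 0) ≡ h v
  sumMap-select-∈ {v} (v∉xs ∷ _) (here refl) rewrite Equivalence.from (≡ᵇ≡true⇔≡ {v}) refl =
    trans (cong (h v +_) (sumMap-select-∉ _ (λ v∈xs → All.lookup v∉xs v∈xs refl))) (ℕP.+-identityʳ (h v))
  sumMap-select-∈ {v} {x ∷ _} (x∉xs ∷ xs!) (there v∈xs) with v ≡ᵇ x in v≡ᵇx
  ... | true  = ⊥-elim (All.lookup x∉xs v∈xs (sym (Equivalence.to ≡ᵇ≡true⇔≡ v≡ᵇx)))
  ... | false = sumMap-select-∈ xs! v∈xs

double : ℕ → ℕ
double zero    = zero
double (suc n) = suc (suc (double n))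

2*≡double : ∀ n → 2 * n ≡ double n
2*≡double zero    = refl
2*≡double (suc n) = cong suc (trans (ℕP.+-suc n (n + 0)) (cong suc (2*≡double n)))

double-+ : ∀ m n → double m + double n ≡ double (m + n)
double-+ zero    n = refl
double-+ (suc m) n = cong (suc ∘ suc) (double-+ m n)

double-∸ : ∀ m n → double m ∸ double n ≡ double (m ∸ n)
double-∸ m       zero    = refl
double-∸ zero    (suc n) = refl
double-∸ (suc m) (suc n) = double-∸ m n

+double-suc : ∀ k m → k + double (suc m) ≡ suc (suc (k + double m))
+double-suc k m = trans (ℕP.+-suc k _) (cong suc (ℕP.+-suc k _))

evenᵇ-+double : ∀ k m → evenᵇ (k + double m) ≡ evenᵇ k
evenᵇ-+double k zero    = cong evenᵇ (ℕP.+-identityʳ k)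
evenᵇ-+double k (suc m) = trans (cong evenᵇ (+double-suc k m)) (evenᵇ-+double k m)

⌊+double/2⌋ : ∀ k m → ⌊ k + double m /2⌋ ≡ ⌊ k /2⌋ + m
⌊+double/2⌋ k zero    = trans (cong ⌊_/2⌋ (ℕP.+-identityʳ k)) (sym (ℕP.+-identityʳ _))
⌊+double/2⌋ k (suc m) =
  trans (cong ⌊_/2⌋ (+double-suc k m)) (trans (cong suc (⌊+double/2⌋ k m)) (sym (ℕP.+-suc _ m)))

sumBelow-double : ∀ n (g : ℕ → ℕ) →
                  sumBelow (double n) g ≡ sumBelow n (λ i → g (double i) + g (suc (double i)))
sumBelow-double zero    g = refl
sumBelow-double (suc n) g =
  trans (sym (ℕP.+-assoc (g 0) (g 1) _)) (cong (g 0 + g 1 +_) (sumBelow-double n (g ∘ suc ∘ suc)))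

module _ (t : ℕ) .{{_ : NonZero t}} where

  [m+n]%t≡[m+n%t]%t : ∀ m n → (m + n) % t ≡ (m + n % t) % t
  [m+n]%t≡[m+n%t]%t m n = begin
    (m + n) % t               ≡⟨ %-distribˡ-+ m n t ⟩
    (m % t + n % t) % t       ≡⟨ cong (λ z → (m % t + z) % t) (m%n%n≡m%n n t) ⟨
    (m % t + n % t % t) % t   ≡⟨ %-distribˡ-+ m (n % t) t ⟨
    (m + n % t) % t           ∎
    where open ≡-Reasoning

  -- adding t ∸ r undoes the shift by r modulo t
  +-cancelˡ-% : ∀ r m n → r ≤ t → (r + m) % t ≡ (r + n) % t → m % t ≡ n % t
  +-cancelˡ-% r m n r≤t eq = begin
    m % t                           ≡⟨ [m+n]%n≡m%n m t ⟨
    (m + t) % t                     ≡⟨ cong (_% t) (unshift m) ⟩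
    ((t ∸ r) + (r + m)) % t         ≡⟨ [m+n]%t≡[m+n%t]%t (t ∸ r) (r + m) ⟩
    ((t ∸ r) + (r + m) % t) % t     ≡⟨ cong (λ z → ((t ∸ r) + z) % t) eq ⟩
    ((t ∸ r) + (r + n) % t) % t     ≡⟨ [m+n]%t≡[m+n%t]%t (t ∸ r) (r + n) ⟨
    ((t ∸ r) + (r + n)) % t         ≡⟨ cong (_% t) (unshift n) ⟨
    (n + t) % t                     ≡⟨ [m+n]%n≡m%n n t ⟩
    n % t                           ∎
    where
    open ≡-Reasoning
    unshift : ∀ k → k + t ≡ (t ∸ r) + (r + k)
    unshift k = trans (ℕP.+-comm k t)
      (trans (cong (_+ k) (sym (ℕP.m∸n+n≡m r≤t))) (ℕP.+-assoc (t ∸ r) r k))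

  Sh<t : ∀ {r q} → r < t → q < t → Sh t r q < t
  Sh<t {r} {q} r<t q<t with r ≤ᵇ q in r≤ᵇq
  ... | true  = ℕP.≤-<-trans (ℕP.m∸n≤m q r) q<t
  ... | false = ℕP.m<n+o⇒m∸n<o (t + q) r (subst (t + q <_) (ℕP.+-comm t r) (ℕP.+-monoʳ-< t q<r))
    where
    q<r : q < r
    q<r = ℕP.≰⇒> (λ r≤q → subst T r≤ᵇq (ℕP.≤⇒≤ᵇ r≤q))

  [r+Sh]%t≡q : ∀ {r q} → r < t → q < t → (r + Sh t r q) % t ≡ q
  [r+Sh]%t≡q {r} {q} r<t q<t with r ≤ᵇ q in r≤ᵇq
  ... | true  = trans (cong (_% t) (ℕP.m+[n∸m]≡n (ℕP.≤ᵇ⇒≤ r q (subst T (sym r≤ᵇq) _)))) (m<n⇒m%n≡m q<t)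
  ... | false = begin
    (r + (t + q ∸ r)) % t   ≡⟨ cong (_% t) (ℕP.m+[n∸m]≡n (ℕP.≤-trans (ℕP.<⇒≤ r<t) (ℕP.m≤m+n t q))) ⟩
    (t + q) % t             ≡⟨ cong (_% t) (ℕP.+-comm t q) ⟩
    (q + t) % t             ≡⟨ [m+n]%n≡m%n q t ⟩
    q % t                   ≡⟨ m<n⇒m%n≡m q<t ⟩
    q                       ∎
    where open ≡-Reasoning

  [r+k]%t≡q⇔k%t≡Sh : ∀ {r q} k → r < t → q < t → (r + k) % t ≡ q ⇔ k % t ≡ Sh t r q
  [r+k]%t≡q⇔k%t≡Sh {r} {q} k r<t q<t = mk⇔
    (λ eq → trans (+-cancelˡ-% r k (Sh t r q) (ℕP.<⇒≤ r<t) (trans eq (sym ([r+Sh]%t≡q r<t q<t))))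
                  (m<n⇒m%n≡m (Sh<t r<t q<t)))
    (λ eq → trans ([m+n]%t≡[m+n%t]%t r k) (trans (cong (λ z → (r + z) % t) eq) ([r+Sh]%t≡q r<t q<t)))

onAxis⇒≡origin : ∀ {d} (v : Vec ℤ d) → onAxis v ≡ true → v ≡ origin d
onAxis⇒≡origin []                 _      = refl
onAxis⇒≡origin (+0 ∷ v)           onAxis = cong (+0 ∷_) (onAxis⇒≡origin v onAxis)
onAxis⇒≡origin (+[1+ _ ] ∷ _)     ()
onAxis⇒≡origin (-[1+ _ ] ∷ _)     ()

onAxis-origin : ∀ d → onAxis (origin d) ≡ true
onAxis-origin zero    = refl
onAxis-origin (suc d) = onAxis-origin d

module PathCounts (d : ℕ) where

  #paths : (List (Step d) → Bool) → ℕ → ℕ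
  #paths p L = count p (allPaths d L)

  #paths-zero : ∀ p → #paths p 0 ≡ (if p [] then 1 else 0)
  #paths-zero p with p []
  ... | true  = refl
  ... | false = refl

  #paths-suc : ∀ p L → #paths p (suc L) ≡ sumMap (allSteps d) (λ s → #paths (p ∘ (s ∷_)) L)
  #paths-suc p L = trans (count-concatMap p (λ s → map (s ∷_) (allPaths d L)) (allSteps d))
                         (sumMap-cong (allSteps d) (λ s → count-map p (s ∷_) (allPaths d L)))

  #paths-false : ∀ L → #paths (λ _ → false) L ≡ 0
  #paths-false L = count-false (allPaths d L)

  #escaping : Vec ℤ d → ℕ → ℕ
  #escaping pos = #paths (escaping pos)

  #escaping-suc : ∀ pos L → #escaping pos (suc L) ≡
                  sumMap (allSteps d) (λ s → if onAxis (move s pos) then 0 else #escaping (move s pos) L)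
  #escaping-suc pos L = trans (#paths-suc (escaping pos) L)
                              (sumMap-cong (allSteps d) (λ s → firstStep (onAxis (move s pos)) (move s pos)))
    where
    firstStep : ∀ b p → #paths (λ ss → not b ∧ escaping p ss) L ≡ (if b then 0 else #escaping p L)
    firstStep true  p = #paths-false L
    firstStep false p = refl

  #escaping₀ : ℕ → ℕ
  #escaping₀ = #escaping (origin d)

  #excursions : Vec ℤ d → ℕ → ℕ
  #excursions pos = #paths (excursion pos)

  #excursions₀ : ℕ → ℕ
  #excursions₀ = #excursions (origin d)

  Eℕ : ℕ → ℕ
  Eℕ n = #excursions₀ (2 * n)

  E∞ℕ : ℕ → ℕ
  E∞ℕ n = #escaping₀ (2 * n)

  -- #excursionTail (onAxis p) p L counts the ways to complete a primitive excursion
  -- in L further steps once its first step has reached p.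
  #excursionTail : Bool → Vec ℤ d → ℕ → ℕ
  #excursionTail true  p zero    = 1
  #excursionTail true  p (suc L) = 0
  #excursionTail false p L       = #excursions p L

  #excursions-suc : ∀ pos L → #excursions pos (suc L) ≡
                    sumMap (allSteps d) (λ s → #excursionTail (onAxis (move s pos)) (move s pos) L)
  #excursions-suc pos zero = trans (#paths-suc (excursion pos) 0) (sumMap-cong (allSteps d) λ s →
    trans (#paths-zero (λ ss → excursion pos (s ∷ ss))) (lastStep (onAxis (move s pos)) (move s pos)))
    where
    lastStep : ∀ b p → (if b then 1 else 0) ≡ #excursionTail b p 0
    lastStep true  p = refl
    lastStep false p = refl
  #excursions-suc pos (suc L) = trans (#paths-suc (excursion pos) (suc L)) (sumMap-cong (allSteps d) λ s →
    trans (#paths-suc _ L) (firstStep (onAxis (move s pos)) (move s pos)))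
    where
    firstStep : ∀ b p → sumMap (allSteps d) (λ s' → #paths (λ ss → not b ∧ excursion p (s' ∷ ss)) L)
                        ≡ #excursionTail b p (suc L)
    firstStep true  p = trans (sumMap-cong (allSteps d) (λ _ → #paths-false L)) (sumMap-zero (allSteps d))
    firstStep false p = sym (#paths-suc (excursion p) L)

module AdmissibleCounts (d : ℕ) (A : List ℕ) (tA : ℕ) .{{_ : NonZero tA}} where

  open PathCounts d

  #admissible : ℕ → Vec ℤ d → ℕ → ℕ
  #admissible x pos = #paths (admissiblePath A tA x pos)

  #admissible₀ : ℕ → ℕ → ℕ
  #admissible₀ x = #admissible x (origin d)

  -- admissible paths from (x, pos), except that the starting point itself is not checked
  #admissibleTail : ℕ → Vec ℤ d → ℕ → ℕ
  #admissibleTail x pos zero    = 1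
  #admissibleTail x pos (suc L) = sumMap (allSteps d) (λ s → #admissible (suc x) (move s pos) L)

  #admissible-unfold : ∀ x pos L →
                       #admissible x pos L ≡ (if pointOK A tA x pos then #admissibleTail x pos L else 0)
  #admissible-unfold x pos zero    = #paths-zero (admissiblePath A tA x pos)
  #admissible-unfold x pos (suc L) = trans (#paths-suc _ L) (startPoint (pointOK A tA x pos))
    where
    startPoint : ∀ b → sumMap (allSteps d) (λ s → #paths (λ ss → b ∧ admissiblePath A tA (suc x) (move s pos) ss) L)
                       ≡ (if b then #admissibleTail x pos (suc L) else 0)
    startPoint true  = refl
    startPoint false = trans (sumMap-cong (allSteps d) (λ _ → #paths-false L)) (sumMap-zero (allSteps d))

  #admissible-offAxis : ∀ x pos L → onAxis pos ≡ false → #admissible x pos L ≡ #admissibleTail x pos L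
  #admissible-offAxis x pos L offAxis = trans (#admissible-unfold x pos L) (if-cong pointOK≡true)
    where
    pointOK≡true : pointOK A tA x pos ≡ true
    pointOK≡true rewrite offAxis = refl

  #admissibleTail-firstReturn : ∀ L x pos → #admissibleTail x pos L ≡
    #escaping pos L + sumBelow L (λ j → #excursions pos (suc j) * #admissible₀ (x + suc j) (L ∸ suc j))
  #admissibleTail-firstReturn zero    x pos = refl
  #admissibleTail-firstReturn (suc L) x pos = begin
      sumMap (allSteps d) (λ s → #admissible (suc x) (move s pos) L)
    ≡⟨ sumMap-cong (allSteps d) (λ s → firstStep (move s pos)) ⟩
      sumMap (allSteps d) (λ s → escapeTerm s + sumBelow (suc L) (λ j → returnTerm j s))
    ≡⟨ sumMap-+ (allSteps d) escapeTerm _ ⟩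
      sumMap (allSteps d) escapeTerm + sumMap (allSteps d) (λ s → sumBelow (suc L) (λ j → returnTerm j s))
    ≡⟨ cong₂ _+_ (#escaping-suc pos L) (sumBelow-sumMap (suc L) (allSteps d) returnTerm) ⟨
      #escaping pos (suc L) + sumBelow (suc L) (λ j → sumMap (allSteps d) (returnTerm j))
    ≡⟨ cong (#escaping pos (suc L) +_) (sumBelow-cong (suc L) λ j →
         trans (sym (sumMap-*ʳ (allSteps d) _ (M j))) (cong (_* M j) (sym (#excursions-suc pos j)))) ⟩
      #escaping pos (suc L) + sumBelow (suc L) (λ j → #excursions pos (suc j) * M j)
    ∎
    where
    open ≡-Reasoning
    M : ℕ → ℕ
    M j = #admissible₀ (x + suc j) (suc L ∸ suc j)
    escapeTerm : Step d → ℕ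
    escapeTerm s = if onAxis (move s pos) then 0 else #escaping (move s pos) L
    returnTerm : ℕ → Step d → ℕ
    returnTerm j s = #excursionTail (onAxis (move s pos)) (move s pos) j * M j
    firstStep : ∀ p → #admissible (suc x) p L ≡
      (if onAxis p then 0 else #escaping p L) + sumBelow (suc L) (λ j → #excursionTail (onAxis p) p j * M j)
    firstStep p with onAxis p in onAxis-p
    ... | true  = begin
        #admissible (suc x) p L
      ≡⟨ cong₂ (λ y v → #admissible y v L) (ℕP.+-comm 1 x) (onAxis⇒≡origin p onAxis-p) ⟩
        M 0
      ≡⟨ trans (cong (1 * M 0 +_) (sumBelow-zero L)) (trans (ℕP.+-identityʳ (1 * M 0)) (ℕP.*-identityˡ (M 0))) ⟨
        1 * M 0 + sumBelow L (λ _ → 0)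
      ∎
    ... | false = begin
        #admissible (suc x) p L
      ≡⟨ #admissible-offAxis (suc x) p L onAxis-p ⟩
        #admissibleTail (suc x) p L
      ≡⟨ #admissibleTail-firstReturn L (suc x) p ⟩
        #escaping p L + sumBelow L (λ j → #excursions p (suc j) * #admissible₀ (suc x + suc j) (L ∸ suc j))
      ≡⟨ cong (#escaping p L +_) (sumBelow-cong L λ j →
           cong (λ y → #excursions p (suc j) * #admissible₀ y (L ∸ suc j)) (sym (ℕP.+-suc x (suc j)))) ⟩
        #escaping p L + sumBelow L (λ j → #excursions p (suc j) * M (suc j))
      ∎

  SameAdmissibility : ℕ → ℕ → Set
  SameAdmissibility x y = ∀ k (pos : Vec ℤ d) → pointOK A tA (k + x) pos ≡ pointOK A tA (k + y) pos

  #admissible-cong : ∀ L {x y} pos → SameAdmissibility x y → #admissible x pos L ≡ #admissible y pos L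
  #admissible-cong L {x} {y} pos x~y = begin
      #admissible x pos L
    ≡⟨ #admissible-unfold x pos L ⟩
      (if pointOK A tA x pos then #admissibleTail x pos L else 0)
    ≡⟨ cong₂ (λ b n → if b then n else 0) (x~y 0 pos) (tails L) ⟩
      (if pointOK A tA y pos then #admissibleTail y pos L else 0)
    ≡⟨ #admissible-unfold y pos L ⟨
      #admissible y pos L
    ∎
    where
    open ≡-Reasoning
    suc-x~suc-y : SameAdmissibility (suc x) (suc y)
    suc-x~suc-y k pos' = begin
      pointOK A tA (k + suc x) pos'   ≡⟨ cong (λ z → pointOK A tA z pos') (ℕP.+-suc k x) ⟩
      pointOK A tA (suc k + x) pos'   ≡⟨ x~y (suc k) pos' ⟩
      pointOK A tA (suc k + y) pos'   ≡⟨ cong (λ z → pointOK A tA z pos') (ℕP.+-suc k y) ⟨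
      pointOK A tA (k + suc y) pos'   ∎
    tails : ∀ L → #admissibleTail x pos L ≡ #admissibleTail y pos L
    tails zero    = refl
    tails (suc L) = sumMap-cong (allSteps d) (λ s → #admissible-cong L (move s pos) suc-x~suc-y)

  double-sameAdmissibility-% : ∀ m → SameAdmissibility (double m) (double (m % tA))
  double-sameAdmissibility-% m k pos
    rewrite evenᵇ-+double k m | evenᵇ-+double k (m % tA) | ⌊+double/2⌋ k m | ⌊+double/2⌋ k (m % tA)
          | [m+n]%t≡[m+n%t]%t tA ⌊ k /2⌋ m = refl

  pointOK-double : ∀ m → pointOK A tA (double m) (origin d) ≡ isYes ((m % tA) ∈? A)
  pointOK-double m rewrite onAxis-origin d | evenᵇ-+double 0 m | ⌊+double/2⌋ 0 m = refl

  pointOK-suc-double : ∀ m → pointOK A tA (suc (double m)) (origin d) ≡ false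
  pointOK-suc-double m rewrite onAxis-origin d | evenᵇ-+double 1 m = refl

  #admissible-double-∈ : ∀ {m} L → m % tA ∈ A →
                         #admissible₀ (double m) L ≡ #admissibleTail (double m) (origin d) L
  #admissible-double-∈ {m} L m%tA∈A = trans (#admissible-unfold (double m) (origin d) L)
    (if-cong (trans (pointOK-double m) (trans (isYes≗does (m % tA ∈? A)) (dec-true (m % tA ∈? A) m%tA∈A))))

  #admissible-double-∉ : ∀ {m} L → ¬ m % tA ∈ A → #admissible₀ (double m) L ≡ 0
  #admissible-double-∉ {m} L m%tA∉A = trans (#admissible-unfold (double m) (origin d) L)
    (if-cong (trans (pointOK-double m) (trans (isYes≗does (m % tA ∈? A)) (dec-false (m % tA ∈? A) m%tA∉A))))

  #admissible-double : Unique A → ∀ m L → #admissible₀ (double m) L ≡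
    sumMap A (λ q → if m % tA ≡ᵇ q then #admissible₀ (double q) L else 0)
  #admissible-double A! m L with (m % tA) ∈? A
  ... | yes m%tA∈A = trans (#admissible-cong L (origin d) (double-sameAdmissibility-% m))
                           (sym (sumMap-select-∈ _ A! m%tA∈A))
  ... | no  m%tA∉A = trans (#admissible-double-∉ L m%tA∉A) (sym (sumMap-select-∉ _ A m%tA∉A))

  #admissible-suc-double : ∀ m L → #admissible₀ (suc (double m)) L ≡ 0
  #admissible-suc-double m L =
    trans (#admissible-unfold (suc (double m)) (origin d) L) (if-cong (pointOK-suc-double m))

  Pℕ : ℕ → ℕ → ℕ
  Pℕ r n = #admissible₀ (2 * r) (2 * n)

  Pℕ≡#admissible-double : ∀ r n → Pℕ r n ≡ #admissible₀ (double r) (double n)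
  Pℕ≡#admissible-double r n = cong₂ #admissible₀ (2*≡double r) (2*≡double n)

  Pℕ-firstReturn : ∀ {r} n → r % tA ∈ A → Pℕ r n ≡
    E∞ℕ n + sumBelow n (λ i → Eℕ (suc i) * #admissible₀ (double (r + suc i)) (double (n ∸ suc i)))
  Pℕ-firstReturn {r} n r%tA∈A = begin
      Pℕ r n
    ≡⟨ Pℕ≡#admissible-double r n ⟩
      #admissible₀ (double r) (double n)
    ≡⟨ #admissible-double-∈ (double n) r%tA∈A ⟩
      #admissibleTail (double r) (origin d) (double n)
    ≡⟨ #admissibleTail-firstReturn (double n) (double r) (origin d) ⟩
      #escaping₀ (double n) + sumBelow (double n) g
    ≡⟨ cong (#escaping₀ (double n) +_) (sumBelow-double n g) ⟩
      #escaping₀ (double n) + sumBelow n (λ i → g (double i) + g (suc (double i)))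
    ≡⟨ cong₂ _+_ (cong #escaping₀ (sym (2*≡double n))) (sumBelow-cong n λ i →
         cong (_+ g (suc (double i))) (oddReturn i)) ⟩
      E∞ℕ n + sumBelow n (λ i → g (suc (double i)))
    ≡⟨ cong (E∞ℕ n +_) (sumBelow-cong n evenReturn) ⟩
      E∞ℕ n + sumBelow n (λ i → Eℕ (suc i) * #admissible₀ (double (r + suc i)) (double (n ∸ suc i)))
    ∎
    where
    open ≡-Reasoning
    g : ℕ → ℕ
    g j = #excursions₀ (suc j) * #admissible₀ (double r + suc j) (double n ∸ suc j)
    oddReturn : ∀ i → g (double i) ≡ 0
    oddReturn i = begin
        #excursions₀ (suc (double i)) * #admissible₀ (double r + suc (double i)) L
      ≡⟨ cong (λ x → #excursions₀ (suc (double i)) * #admissible₀ x L)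
              (trans (ℕP.+-suc (double r) (double i)) (cong suc (double-+ r i))) ⟩
        #excursions₀ (suc (double i)) * #admissible₀ (suc (double (r + i))) L
      ≡⟨ cong (#excursions₀ (suc (double i)) *_) (#admissible-suc-double (r + i) L) ⟩
        #excursions₀ (suc (double i)) * 0
      ≡⟨ ℕP.*-zeroʳ (#excursions₀ (suc (double i))) ⟩
        0
      ∎
      where
      L : ℕ
      L = double n ∸ suc (double i)
    evenReturn : ∀ i → g (suc (double i)) ≡
                 Eℕ (suc i) * #admissible₀ (double (r + suc i)) (double (n ∸ suc i))
    evenReturn i = begin
        #excursions₀ (double (suc i)) * #admissible₀ (double r + double (suc i)) (double n ∸ double (suc i))
      ≡⟨ cong₂ (λ L x → #excursions₀ L * #admissible₀ x (double n ∸ double (suc i)))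
               (sym (2*≡double (suc i))) (double-+ r (suc i)) ⟩
        Eℕ (suc i) * #admissible₀ (double (r + suc i)) (double n ∸ double (suc i))
      ≡⟨ cong (λ L → Eℕ (suc i) * #admissible₀ (double (r + suc i)) L) (double-∸ n (suc i)) ⟩
        Eℕ (suc i) * #admissible₀ (double (r + suc i)) (double (n ∸ suc i))
      ∎

  sectionℕ : ℕ → ℕ → ℕ
  sectionℕ s i = if i % tA ≡ᵇ s then Eℕ i else 0

  Pℕ-equation : Unique A → All (_< tA) A → ∀ {r} n → r ∈ A →
    Pℕ r n ≡ E∞ℕ n + sumMap A (λ q → sumBelow (suc n) (λ i → sectionℕ (Sh tA r q) i * Pℕ q (n ∸ i)))
  Pℕ-equation A! A<tA {r} n r∈A = begin
      Pℕ r n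
    ≡⟨ Pℕ-firstReturn n (subst (_∈ A) (sym (m<n⇒m%n≡m r<tA)) r∈A) ⟩
      E∞ℕ n + sumBelow n (λ i → Eℕ (suc i) * #admissible₀ (double (r + suc i)) (double (n ∸ suc i)))
    ≡⟨ cong (E∞ℕ n +_) (sumBelow-cong n returnAt) ⟩
      E∞ℕ n + sumBelow n (λ i → sumMap A (λ q → sectionℕ (Sh tA r q) (suc i) * Pℕ q (n ∸ suc i)))
    ≡⟨ cong (E∞ℕ n +_) (sumBelow-sumMap n A (λ i q → sectionℕ (Sh tA r q) (suc i) * Pℕ q (n ∸ suc i))) ⟩
      E∞ℕ n + sumMap A (λ q → sumBelow n (λ i → sectionℕ (Sh tA r q) (suc i) * Pℕ q (n ∸ suc i)))
    ≡⟨ cong (E∞ℕ n +_) (sumMap-cong A λ q →  -- the i = 0 term vanishes since Eℕ 0 reduces to 0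
         cong (λ e → e * Pℕ q n + sumBelow n (λ i → sectionℕ (Sh tA r q) (suc i) * Pℕ q (n ∸ suc i)))
              (if-eta (0 % tA ≡ᵇ Sh tA r q))) ⟨
      E∞ℕ n + sumMap A (λ q → sumBelow (suc n) (λ i → sectionℕ (Sh tA r q) i * Pℕ q (n ∸ i)))
    ∎
    where
    open ≡-Reasoning
    r<tA : r < tA
    r<tA = All.lookup A<tA r∈A
    returnAt : ∀ i → Eℕ (suc i) * #admissible₀ (double (r + suc i)) (double (n ∸ suc i)) ≡
                     sumMap A (λ q → sectionℕ (Sh tA r q) (suc i) * Pℕ q (n ∸ suc i))
    returnAt i = begin
        Eℕ (suc i) * #admissible₀ (double (r + suc i)) L
      ≡⟨ cong (Eℕ (suc i) *_) (#admissible-double A! (r + suc i) L) ⟩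
        Eℕ (suc i) * sumMap A (λ q → if (r + suc i) % tA ≡ᵇ q then #admissible₀ (double q) L else 0)
      ≡⟨ sumMap-*ˡ A _ (Eℕ (suc i)) ⟩
        sumMap A (λ q → Eℕ (suc i) * (if (r + suc i) % tA ≡ᵇ q then #admissible₀ (double q) L else 0))
      ≡⟨ sumMap-cong-∈ A (λ {q} q∈A → returnTo q (All.lookup A<tA q∈A)) ⟩
        sumMap A (λ q → sectionℕ (Sh tA r q) (suc i) * Pℕ q (n ∸ suc i))
      ∎
      where
      L : ℕ
      L = double (n ∸ suc i)
      returnTo : ∀ q → q < tA →
                 Eℕ (suc i) * (if (r + suc i) % tA ≡ᵇ q then #admissible₀ (double q) L else 0) ≡
                 sectionℕ (Sh tA r q) (suc i) * Pℕ q (n ∸ suc i)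
      returnTo q q<tA = trans (*-if-else-0 ((r + suc i) % tA ≡ᵇ q) (Eℕ (suc i)) _)
        (cong₂ (λ b x → (if b then Eℕ (suc i) else 0) * x)
               (≡ᵇ-cong ([r+k]%t≡q⇔k%t≡Sh tA (suc i) r<tA q<tA))
               (sym (Pℕ≡#admissible-double q (n ∸ suc i))))

sumℚ-map-applyUpTo : ∀ m (k : ℕ → ℕ) {h : ℕ → ℚ} (g : ℕ → ℕ) → (∀ i → h i ≡ ℕtoℚ (g i)) →
                     sumℚ (map h (applyUpTo k m)) ≡ ℕtoℚ (sumBelow m (g ∘ k))
sumℚ-map-applyUpTo zero    k g h≡g = refl
sumℚ-map-applyUpTo (suc m) k g h≡g =
  trans (cong₂ ℚ._+_ (h≡g (k 0)) (sumℚ-map-applyUpTo m (k ∘ suc) g h≡g)) (sym (ℕtoℚ-+ (g (k 0)) _))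

sumℚ-map-applyUpTo-cong : ∀ m (k : ℕ → ℕ) {h h′ : ℕ → ℚ} → (∀ i → i < m → h (k i) ≡ h′ (k i)) →
                          sumℚ (map h (applyUpTo k m)) ≡ sumℚ (map h′ (applyUpTo k m))
sumℚ-map-applyUpTo-cong zero    k h≡h′ = refl
sumℚ-map-applyUpTo-cong (suc m) k h≡h′ =
  cong₂ ℚ._+_ (h≡h′ 0 ℕ.z<s) (sumℚ-map-applyUpTo-cong m (k ∘ suc) (λ i i<m → h≡h′ (suc i) (ℕ.s<s i<m)))

*ₚ-ℕtoℚ : ∀ {F G : FPS} (f g : ℕ → ℕ) → F ≈ₚ (ℕtoℚ ∘ f) → G ≈ₚ (ℕtoℚ ∘ g) →
          ∀ n → (F *ₚ G) n ≡ ℕtoℚ (sumBelow (suc n) (λ i → f i * g (n ∸ i)))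
*ₚ-ℕtoℚ f g F≈f G≈g n = sumℚ-map-applyUpTo (suc n) (λ i → i) (λ i → f i * g (n ∸ i))
  (λ i → trans (cong₂ ℚ._*_ (F≈f i) (G≈g (n ∸ i))) (sym (ℕtoℚ-* (f i) (g (n ∸ i)))))

*ₚ-cong-below : ∀ {F G H : FPS} n → F 0 ≡ 0ℚ → (∀ k → k < n → G k ≡ H k) → (F *ₚ G) n ≡ (F *ₚ H) n
*ₚ-cong-below {F} {G} {H} n F₀≡0 G≡H = cong₂ ℚ._+_
  (trans (F₀*X≡0 G) (sym (F₀*X≡0 H)))
  (sumℚ-map-applyUpTo-cong n suc λ i i<n → cong (F (suc i) ℚ.*_) (G≡H (n ∸ suc i) (n∸suc<n i<n)))
  where
  F₀*X≡0 : (X : FPS) → F 0 ℚ.* X n ≡ 0ℚ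
  F₀*X≡0 X = trans (cong (ℚ._* X n) F₀≡0) (ℚP.*-zeroˡ (X n))
  n∸suc<n : ∀ {i} → i < n → n ∸ suc i < n
  n∸suc<n {i} i<n = ℕP.∸-monoʳ-< (ℕ.s≤s ℕ.z≤n) i<n

sumₚ-ℕtoℚ : ∀ (qs : List ℕ) {F : ℕ → FPS} (f : ℕ → ℕ) n → (∀ q → F q n ≡ ℕtoℚ (f q)) →
            sumₚ qs F n ≡ ℕtoℚ (sumMap qs f)
sumₚ-ℕtoℚ []       f n F≡f = refl
sumₚ-ℕtoℚ (q ∷ qs) f n F≡f =
  trans (cong₂ ℚ._+_ (F≡f q) (sumₚ-ℕtoℚ qs f n F≡f)) (sym (ℕtoℚ-+ (f q) _))

sumₚ-cong : ∀ (qs : List ℕ) {F G : ℕ → FPS} n → (∀ {q} → q ∈ qs → F q n ≡ G q n) →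
            sumₚ qs F n ≡ sumₚ qs G n
sumₚ-cong []       n F≡G = refl
sumₚ-cong (q ∷ qs) n F≡G = cong₂ ℚ._+_ (F≡G (here refl)) (sumₚ-cong qs n (F≡G ∘ there))

multisection-ℕtoℚ : ∀ m .{{_ : NonZero m}} s (f : ℕ → ℕ) →
                    multisection m s (ℕtoℚ ∘ f) ≈ₚ (ℕtoℚ ∘ λ i → if i % m ≡ᵇ s then f i else 0)
multisection-ℕtoℚ m s f i = sym (if-float ℕtoℚ (i % m ≡ᵇ s))

module _ (d : ℕ) (A : List ℕ) (tA : ℕ) .{{_ : NonZero tA}} where

  open PathCounts d
  open AdmissibleCounts d A tA

  P-solves : Unique A → All (_< tA) A → Solves d A tA (P d A tA)
  P-solves A! A<tA r r∈A n = begin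
      P d A tA r n ℚ.- sumₚ A (λ q → multisection tA (Sh tA r q) (E d) *ₚ P d A tA q) n
    ≡⟨ cong₂ ℚ._-_ (cong ℕtoℚ (Pℕ-equation A! A<tA n r∈A))
                   (sumₚ-ℕtoℚ A _ n λ q → *ₚ-ℕtoℚ (sectionℕ (Sh tA r q)) (Pℕ q)
                                             (multisection-ℕtoℚ tA (Sh tA r q) Eℕ) (λ _ → refl) n) ⟩
      ℕtoℚ (E∞ℕ n + S) ℚ.- ℕtoℚ S
    ≡⟨ cong (ℚ._- ℕtoℚ S) (ℕtoℚ-+ (E∞ℕ n) S) ⟩
      (ℕtoℚ (E∞ℕ n) ℚ.+ ℕtoℚ S) ℚ.- ℕtoℚ S
    ≡⟨ //-rightDividesʳ (ℕtoℚ S) (ℕtoℚ (E∞ℕ n)) ⟩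
      E∞ d n
    ∎
    where
    open ≡-Reasoning
    S : ℕ
    S = sumMap A (λ q → sumBelow (suc n) (λ i → sectionℕ (Sh tA r q) i * Pℕ q (n ∸ i)))

  Solves⇒recurrence : ∀ {X : ℕ → FPS} → Solves d A tA X → ∀ {r} → r ∈ A → ∀ n →
    X r n ≡ E∞ d n ℚ.+ sumₚ A (λ q → multisection tA (Sh tA r q) (E d) *ₚ X q) n
  Solves⇒recurrence {X} X-sol {r} r∈A n =
    trans (sym (//-rightDividesˡ S (X r n))) (cong (ℚ._+ S) (X-sol r r∈A n))
    where
    S : ℚ
    S = sumₚ A (λ q → multisection tA (Sh tA r q) (E d) *ₚ X q) n

  Solves-unique : ∀ {X Y : ℕ → FPS} → Solves d A tA X → Solves d A tA Y → ∀ r → r ∈ A → X r ≈ₚ Y r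
  Solves-unique {X} {Y} X-sol Y-sol r r∈A n = <-rec (λ m → ∀ {r} → r ∈ A → X r m ≡ Y r m) step n r∈A
    where
    step : ∀ m → (∀ {k} → k < m → ∀ {r} → r ∈ A → X r k ≡ Y r k) → ∀ {r} → r ∈ A → X r m ≡ Y r m
    step m ih {r} r∈A = begin
        X r m
      ≡⟨ Solves⇒recurrence X-sol r∈A m ⟩
        E∞ d m ℚ.+ sumₚ A (λ q → multisection tA (Sh tA r q) (E d) *ₚ X q) m
      ≡⟨ cong (E∞ d m ℚ.+_) (sumₚ-cong A m λ {q} q∈A →
           *ₚ-cong-below {multisection tA (Sh tA r q) (E d)} m (if-eta (0 % tA ≡ᵇ Sh tA r q))
                         (λ k k<m → ih k<m q∈A)) ⟩
        E∞ d m ℚ.+ sumₚ A (λ q → multisection tA (Sh tA r q) (E d) *ₚ Y q) m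
      ≡⟨ Solves⇒recurrence Y-sol r∈A m ⟨
        Y r m
      ∎
      where open ≡-Reasoning

theorem1 : (d : ℕ) → 1 ≤ d → (tA : ℕ) .{{_ : NonZero tA}} → (as : List ℕ) →
           Linked _<_ (0 ∷ as) → All (_< tA) (0 ∷ as) →
           Solves d (0 ∷ as) tA (P d (0 ∷ as) tA)
           × ((X : ℕ → FPS) → Solves d (0 ∷ as) tA X →
                ∀ r → r ∈ (0 ∷ as) → X r ≈ₚ P d (0 ∷ as) tA r)
theorem1 d _ tA as sorted A<tA = P-solution , λ X X-sol → Solves-unique d A tA X-sol P-solution
  where
  A : List ℕ
  A = 0 ∷ as
  A! : Unique A
  A! = AllPairs.map ℕP.<⇒≢ (Linked⇒AllPairs ℕP.<-trans sorted)
  P-solution : Solves d A tA (P d A tA)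
  P-solution = P-solves d A tA A! A<tA
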